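{- Let $G=(V,E)$ be a graph and let $\mathcal{P}=(V_{u,v}\mid (u,v)\in V\times V)$ be a smooth T-partition system on $G$. Then the groupoid associated with $\mathcal{P}$ is a smooth travel groupoid on $G$.
   Context: Graphs are undirected, possibly infinite, with no loops and no multiple edges. For $u\in V$, $N_G[u]=\{u\}\cup\{v\mid\{u,v\}\in E\}$. A T-partition system on $G$ is a family $(V_{u,v}\subseteq V\mid (u,v)\in V\times V)$ such that: (P0) for every $u$, $\{V_{u,v}\mid v\in N_G[u]\}$ is a partition of $V$; (P1a) $V_{u,u}=\{u\}$; (P1b) for $u\neq v$: $v\in V_{u,v}$ iff $\{u,v\}\in E$; (P1c) for $u\neq v$: $V_{u,v}=\emptyset$ iff $\{u,v\}\notin E$; (P2) for $u\neq v$: $V_{u,v}\cap V_{v,u}=\emptyset$. It is smooth if (R4): for all $u,v,x,y,z\in V$, if $x,y\in V_{u,v}$ and $x\in V_{y,z}$ then $z\in V_{u,v}$. The groupoid associated with a T-partition system is $(V,*)$ where $u*v$ is the unique $w$ with $v\in V_{u,w}$. A travel groupoid is a nonempty set $V$ with binary operation $*$ satisfying (t1) $(u*v)*u=u$ for all $u,v$ and (t2) if $(u*v)*v=u$ then $u=v$; it is on $G$ if $V(G)=V$ and $E(G)=\{\{u,v\}\mid u\neq v,\ u*v=v\}$; it is smooth if for all $u,v,w$, $u*v=u*w$ implies $u*(v*w)=u*v$. -}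

module Defs where

open import Level using (Level; _⊔_; suc)
open import Data.Product using (Σ; _×_; _,_; proj₁)
open import Data.Sum using (_⊎_)
open import Data.Empty using (⊥)
open import Relation.Nullary using (¬_)
open import Relation.Binary.PropositionalEquality using (_≡_; _≢_)
open import Function.Bundles using (_⇔_)

record Graph (a e : Level) : Set (suc (a ⊔ e)) where
  field
    V     : Set a
    E     : V → V → Set e
    sym   : ∀ {u v} → E u v → E v u
    irrefl : ∀ {u} → ¬ E u u

module _ {a e : Level} (G : Graph a e) where
  open Graph G

  N[_] : V → V → Set (a ⊔ e)
  N[ u ] w = (w ≡ u) ⊎ E u w

  -- A T-partition system; Vs u v x  means  x ∈ V_{u,v}.
  record TPartitionSystem (ℓ : Level) : Set (a ⊔ e ⊔ suc ℓ) where
    field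
      Vs : V → V → V → Set ℓ
      P0-cover    : ∀ u x → Σ V λ v → N[ u ] v × Vs u v x
      P0-disjoint : ∀ u v v' x → N[ u ] v → N[ u ] v' →
                    Vs u v x → Vs u v' x → v ≡ v'
      P1a : ∀ u x → Vs u u x ⇔ (x ≡ u)
      P1b : ∀ u v → u ≢ v → Vs u v v ⇔ E u v
      P1c : ∀ u v → u ≢ v → (∀ x → ¬ Vs u v x) ⇔ (¬ E u v)
      P2 : ∀ u v → u ≢ v → ∀ x → Vs u v x → Vs v u x → ⊥

    Smooth : Set (a ⊔ ℓ)
    Smooth = ∀ u v x y z → Vs u v x → Vs u v y → Vs y z x → Vs u v z

    -- the associated groupoid: u * v is the w (in N[u]) with v ∈ V_{u,w};
    -- it is unique by P0-disjoint and P1c.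
    _*ᴾ_ : V → V → V
    u *ᴾ v = proj₁ (P0-cover u v)

  record IsSmoothTravelGroupoidOn (_*_ : V → V → V) : Set (a ⊔ e) where
    field
      nonempty : V
      t1 : ∀ u v → (u * v) * u ≡ u
      t2 : ∀ u v → (u * v) * v ≡ u → u ≡ v
      -- E(G) = { {u,v} | u ≠ v, u * v = v }  (as a set of unordered pairs)
      onG : ∀ u v → E u v ⇔ (u ≢ v × ((u * v ≡ v) ⊎ (v * u ≡ u)))
      smooth : ∀ u v w → u * v ≡ u * w → u * (v * w) ≡ u * v

module Submission where

-- Write u * v for the unique w ∈ N[u] with v ∈ V_{u,w}.  Everything rests on
-- two facts about this operation, valid for ANY T-partition system:
--   * it is characterised by its defining property ("*-unique"): whenever
--     w ∈ N[u] and v ∈ V_{u,w}, then u * v ≡ w  (this is P0-disjointness);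
--   * its value is a closed neighbour of u: either u * v ≡ u or u ~ u * v.
-- From these and P1a/P1b one gets u * u ≡ u and u * v ≡ v for every edge uv,
-- which yield (t1), the description of the edge set, and, together with P2,
-- (t2).  Only the last axiom, smoothness of the groupoid, uses (R4): if
-- u * v ≡ u * w = m then v, w ∈ V_{u,m} and w ∈ V_{v, v * w}, so R4 puts
-- v * w into V_{u,m}, i.e. u * (v * w) ≡ m.

open import Defs
open import Data.Product using (_×_; _,_; proj₁; proj₂)
open import Data.Sum using (_⊎_; inj₁; inj₂)
open import Data.Empty using (⊥-elim)
open import Function using (_∘_)
open import Function.Bundles using (_⇔_; mk⇔; Equivalence)
open import Relation.Binary.PropositionalEquality

module TPartitionGroupoid {a e ℓ} (G : Graph a e) (P : TPartitionSystem G ℓ) where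
  open Graph G using (V; E; irrefl)
  open TPartitionSystem P
  open Equivalence

  infixl 7 _*_
  _*_ : V → V → V
  _*_ = _*ᴾ_

  edge⇒≢ : ∀ {u w} → E u w → u ≢ w
  edge⇒≢ e refl = irrefl e

  *-neighbour : ∀ u v → N[_] G u (u * v)
  *-neighbour u v = proj₁ (proj₂ (P0-cover u v))

  *-block : ∀ u v → Vs u (u * v) v
  *-block u v = proj₂ (proj₂ (P0-cover u v))

  *-unique : ∀ {u v w} → N[_] G u w → Vs u w v → u * v ≡ w
  *-unique {u} {v} n s = P0-disjoint u (u * v) _ v (*-neighbour u v) n (*-block u v) s

  *-idem : ∀ u → u * u ≡ u
  *-idem u = *-unique (inj₁ refl) (from (P1a u u) refl)

  edge⇒*≡ : ∀ {u v} → E u v → u * v ≡ v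
  edge⇒*≡ {u} {v} uv = *-unique (inj₂ uv) (from (P1b u v (edge⇒≢ uv)) uv)

  *≡⇒edge : ∀ {u v} → u ≢ v → u * v ≡ v → E u v
  *≡⇒edge {u} {v} u≢v eq with *-neighbour u v
  ... | inj₁ u*v≡u = ⊥-elim (u≢v (trans (sym u*v≡u) eq))
  ... | inj₂ u~u*v = subst (E u) eq u~u*v

  *-return : ∀ u v → (u * v) * u ≡ u
  *-return u v with u * v | *-neighbour u v
  ... | _ | inj₁ refl = *-idem u
  ... | _ | inj₂ u~w  = edge⇒*≡ (Graph.sym G u~w)

  -- (t2): if w = u * v ≠ u, then v ∈ V_{u,w}; were w * v ≡ u, also v ∈ V_{w,u},
  -- contradicting P2.  If w = u, then v ∈ V_{u,u} = {u}.
  *-no-bounce : ∀ u v → (u * v) * v ≡ u → u ≡ v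
  *-no-bounce u v eq with u * v | *-neighbour u v | *-block u v
  ... | _ | inj₁ refl | v∈Vuu = sym (to (P1a u v) v∈Vuu)
  ... | w | inj₂ u~w  | v∈Vuw =
    ⊥-elim (P2 u w (edge⇒≢ u~w) v v∈Vuw (subst (λ z → Vs w z v) eq (*-block w v)))

  edge⇔* : ∀ u v → E u v ⇔ (u ≢ v × ((u * v ≡ v) ⊎ (v * u ≡ u)))
  edge⇔* u v = mk⇔ (λ uv → edge⇒≢ uv , inj₁ (edge⇒*≡ uv)) edge-from-*
    where
    edge-from-* : u ≢ v × ((u * v ≡ v) ⊎ (v * u ≡ u)) → E u v
    edge-from-* (u≢v , inj₁ eq) = *≡⇒edge u≢v eq
    edge-from-* (u≢v , inj₂ eq) = Graph.sym G (*≡⇒edge (u≢v ∘ sym) eq)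

  -- (R4) makes the groupoid smooth: with m = u * v = u * w, both v and w lie in
  -- V_{u,m}, and w ∈ V_{v, v * w}, so R4 gives v * w ∈ V_{u,m}.
  *-smooth : Smooth → ∀ u v w → u * v ≡ u * w → u * (v * w) ≡ u * v
  *-smooth R4 u v w eq =
    *-unique (*-neighbour u v)
      (R4 u (u * v) w v (v * w)
          (subst (λ m → Vs u m w) (sym eq) (*-block u w)) (*-block u v) (*-block v w))

lemma4p8 : ∀ {a e ℓ} (G : Graph a e) → Graph.V G →
           (P : TPartitionSystem G ℓ) → TPartitionSystem.Smooth P →
           IsSmoothTravelGroupoidOn G (TPartitionSystem._*ᴾ_ P)
lemma4p8 G v₀ P R4 = record
  { nonempty = v₀
  ; t1       = *-return
  ; t2       = *-no-bounce
  ; onG      = edge⇔*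
  ; smooth   = *-smooth R4
  }
  where open TPartitionGroupoid G P
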